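{- If $G=(V,E)$ is a JM graph (a simple graph without isolated vertices, regarded as the $2$-uniform hypergraph $E\subseteq 2^V$, which is JM), then $4\le|V|\le6$.
   Context: For a hypergraph $\mathcal H$ on ground set $V$: the game $NIM_{\mathcal H}$ is played on positions $x\in\mathbb{Z}_{\ge 0}^V$; a move $x\to x'$ chooses $H\in\mathcal H$ and goes to any $x'\in\mathbb Z_{\ge0}^V$ with $x'_i<x_i$ for $i\in H$ and $x'_i=x_i$ for $i\notin H$; players alternate and the player who cannot move loses. The Sprague–Grundy function is $\mathcal G_{\mathcal H}(x)=\mathrm{mex}\{\mathcal G_{\mathcal H}(x') : x\to x' \text{ a move}\}$. The height $h_{\mathcal H}(x)$ is the maximum number of consecutive moves possible from $x$. With $e$ the all-ones vector, $m(x)=\min_{i}x_i$, $y_{\mathcal H}(x)=h_{\mathcal H}(x-m(x)e)+1$, $v_{\mathcal H}(x)=\binom{y_{\mathcal H}(x)}{2}+\big((m(x)-\binom{y_{\mathcal H}(x)}{2}-1)\bmod y_{\mathcal H}(x)\big)$ (residue in $\{0,\dots,y_{\mathcal H}(x)-1\}$), $f_{\mathcal H}(x)=h_{\mathcal H}(x)$ if $m(x)\le\binom{y_{\mathcal H}(x)}{2}$, else $v_{\mathcal H}(x)$. $\mathcal H$ is JM if $\mathcal G_{\mathcal H}=f_{\mathcal H}$ on $\mathbb Z_{\ge0}^V$. -}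

module Defs where

open import Data.Nat using (ℕ; zero; suc; _+_; _∸_; _≤_; _<_; _⊓_; _%_)
open import Data.Nat.Combinatorics using (_C_)
open import Data.Fin using (Fin)
import Data.Fin as F
open import Data.Fin.Subset using (Subset; _∈_; _∉_; ⁅_⁆; _∪_)
open import Data.Product using (Σ; ∃; _×_; _,_)
open import Relation.Binary.PropositionalEquality using (_≡_; _≢_)
open import Relation.Nullary using (¬_)

Pos : ℕ → Set
Pos n = Fin n → ℕ

Hypergraph : ℕ → Set₁
Hypergraph n = Subset n → Set

Move : ∀ {n} → Hypergraph n → Pos n → Pos n → Set
Move {n} 𝓗 x x' =
  Σ (Subset n) λ H → 𝓗 H ×
    ((i : Fin n) → (i ∈ H → x' i < x i) × (i ∉ H → x' i ≡ x i))

data Play {n} (𝓗 : Hypergraph n) : Pos n → ℕ → Set where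
  stop : ∀ {x} → Play 𝓗 x 0
  step : ∀ {x x' k} → Move 𝓗 x x' → Play 𝓗 x' k → Play 𝓗 x (suc k)

IsHeight : ∀ {n} → Hypergraph n → (Pos n → ℕ) → Set
IsHeight 𝓗 h = ∀ x → Play 𝓗 x (h x) × (∀ k → Play 𝓗 x k → k ≤ h x)

-- g is the Sprague–Grundy function: g x = mex { g x' : x → x' }.
IsSG : ∀ {n} → Hypergraph n → (Pos n → ℕ) → Set
IsSG 𝓗 g = ∀ x →
  (∀ x' → Move 𝓗 x x' → g x' ≢ g x) ×
  (∀ k → k < g x → ∃ λ x' → Move 𝓗 x x' × g x' ≡ k)

minPos : ∀ {n} → Pos (suc n) → ℕ
minPos {zero} x = x F.zero
minPos {suc n} x = x F.zero ⊓ minPos (λ i → x (F.suc i))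

fH : ∀ {n} → (Pos (suc n) → ℕ) → Pos (suc n) → ℕ
fH h x with minPos x
... | m with h (λ i → x i ∸ m)
...   | hy with suc hy C 2 | m Data.Nat.≤? (suc hy C 2)
...     | c | Relation.Nullary.yes _ = h x
...     | c | Relation.Nullary.no _ = c + ((m ∸ c ∸ 1) % suc hy)

JM : ∀ {n} → Hypergraph (suc n) → Set
JM 𝓗 = Σ (Pos _ → ℕ) λ h → IsHeight 𝓗 h × IsSG 𝓗 (fH h)

record SimpleGraph (n : ℕ) : Set₁ where
  field
    Adj   : Fin n → Fin n → Set
    irrefl : ∀ i → ¬ Adj i i
    sym   : ∀ {i j} → Adj i j → Adj j i

NoIsolated : ∀ {n} → SimpleGraph n → Set
NoIsolated {n} G = (i : Fin n) → ∃ λ j → SimpleGraph.Adj G i j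

edgeHypergraph : ∀ {n} → SimpleGraph n → Hypergraph n
edgeHypergraph G S = ∃ λ i → ∃ λ j → SimpleGraph.Adj G i j × S ≡ ⁅ i ⁆ ∪ ⁅ j ⁆

module Submission where

-- Only two values of f = fH h are needed: the all-ones position has value 0,
-- and a position with an empty pile has value equal to its height. Playing
-- from two special positions then gives two graph properties:
--   (A) playing an edge {c,d} from the all-ones position reaches a position
--       of nonzero value, hence positive height, so some edge is disjoint
--       from {c,d};
--   (B) from the all-ones position with pile r emptied, whenever G − r has an
--       edge, some move reaches value 0, i.e. height 0: the edge {c,d} used
--       by that move covers every edge of G − r.
-- The rest is pure graph combinatorics for a simple graph with (A) and (B).
-- Two disjoint edges give |V| ≥ 4. If |V| ≥ 7, fix disjoint edges {u,v},
-- {a,b} and three further vertices r₁, r₂, r₃. The covering edge e_i of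
-- G − rᵢ has one endpoint in {u,v} and one in {a,b}; by (A) rᵢ has a
-- neighbour sᵢ ∉ e_i, and sᵢ ∈ e_j for j ≠ i. Then any two of s₁, s₂, s₃
-- share a covering edge, hence lie on opposite sides {u,v} / {a,b}, which is
-- impossible for three vertices.

open import Defs
open import Data.Nat using (ℕ; zero; suc; _≤_; _<_; z≤n; s≤s)
open import Data.Nat.Properties
  using (≤-refl; ≤-trans; <-trans; n<1+n; m⊓n≤m; m⊓n≤n; n≤0⇒n≡0; n<1⇒n≡0; n≮0; ≮⇒≥; n≢0⇒n>0)
open import Data.Product using (∃; ∃₂; _×_; _,_; proj₁; proj₂)
open import Data.Sum using (_⊎_; inj₁; inj₂)
open import Data.Empty using (⊥; ⊥-elim)
open import Data.Fin using (Fin) renaming (zero to fzero; suc to fsuc)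
import Data.Fin as Fin
open import Data.Fin.Properties using (_≟_; ¬∀⟶∃¬; pigeonhole; <⇒notInjective)
open import Data.Fin.Subset using (⁅_⁆; _∪_) renaming (_∈_ to _∈ˢ_)
open import Data.Fin.Subset.Properties using (x∈⁅y⁆⇒x≡y; x∈⁅x⁆; x∈p∪q⁻; x∈p∪q⁺)
open import Data.List using (List; []; _∷_; length; lookup)
open import Data.List.Relation.Unary.Any using (here; there; any?; index)
open import Data.List.Relation.Unary.Any.Properties using (lookup-index)
open import Data.List.Membership.Propositional using (_∈_; _∉_)
import Data.Vec as Vec
open import Function.Definitions using (Injective)
open import Relation.Binary.PropositionalEquality
open import Relation.Nullary using (¬_; Dec; yes; no)
open import Relation.Nullary.Decidable using (_⊎-dec_)

Endpoint : ∀ {N} → Fin N → Fin N → Fin N → Set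
Endpoint x c d = x ≡ c ⊎ x ≡ d

endpoint? : ∀ {N} (x c d : Fin N) → Dec (Endpoint x c d)
endpoint? x c d = (x ≟ c) ⊎-dec (x ≟ d)

avoids : ∀ {N} {r i j : Fin N} → i ≢ r → j ≢ r → ¬ Endpoint r i j
avoids i≢r j≢r (inj₁ refl) = i≢r refl
avoids i≢r j≢r (inj₂ refl) = j≢r refl

separated : ∀ {N} {x y c d : Fin N} → Endpoint x c d → ¬ Endpoint y c d → x ≢ y
separated x∈ y∉ refl = y∉ x∈

exhaust : ∀ {N} {x y z c d : Fin N} →
  Endpoint x c d → Endpoint y c d → x ≢ y → Endpoint z c d → Endpoint z x y
exhaust (inj₁ refl) (inj₁ refl) x≢y _ = ⊥-elim (x≢y refl)
exhaust (inj₂ refl) (inj₂ refl) x≢y _ = ⊥-elim (x≢y refl)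
exhaust (inj₁ refl) (inj₂ refl) _ z∈ = z∈
exhaust (inj₂ refl) (inj₁ refl) _ (inj₁ refl) = inj₂ refl
exhaust (inj₂ refl) (inj₁ refl) _ (inj₂ refl) = inj₁ refl

Disjoint : ∀ {N} → Fin N → Fin N → Fin N → Fin N → Set
Disjoint c d a b = ∀ {x} → Endpoint x c d → Endpoint x a b → ⊥

Meets : ∀ {N} → Fin N → Fin N → Fin N → Fin N → Set
Meets c d a b = ∃ λ t → Endpoint t c d × Endpoint t a b

-- A list of fewer than N elements of Fin N misses one of them: otherwise
-- the position of each element in the list would be an injection into a
-- smaller Fin.
missing : ∀ {N} (L : List (Fin N)) → length L < N → ∃ λ w → w ∉ L
missing {N} L short = ¬∀⟶∃¬ N (_∈ L) (λ w → any? (w ≟_) L) all-listed⇒⊥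
  where
  all-listed⇒⊥ : (∀ w → w ∈ L) → ⊥
  all-listed⇒⊥ listed = <⇒notInjective short position-injective
    where
    position-injective : Injective _≡_ _≡_ (λ w → index (listed w))
    position-injective {i} {j} same = begin
      i                           ≡⟨ lookup-index (listed i) ⟩
      lookup L (index (listed i)) ≡⟨ cong (lookup L) same ⟩
      lookup L (index (listed j)) ≡⟨ sym (lookup-index (listed j)) ⟩
      j                           ∎
      where open ≡-Reasoning

four-distinct : ∀ {N} {p q r s : Fin N} →
  p ≢ q → p ≢ r → p ≢ s → q ≢ r → q ≢ s → r ≢ s → 4 ≤ N
four-distinct {N} {p} {q} {r} {s} pq pr ps qr qs rs = ≮⇒≥ λ N<4 →
  let (i , j , i<j , same) = pigeonhole N<4 (Vec.lookup listing) in collision i j i<j same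
  where
  listing : Vec.Vec (Fin N) 4
  listing = p Vec.∷ q Vec.∷ r Vec.∷ s Vec.∷ Vec.[]
  collision : ∀ i j → i Fin.< j → Vec.lookup listing i ≢ Vec.lookup listing j
  collision fzero (fsuc fzero) _ = pq
  collision fzero (fsuc (fsuc fzero)) _ = pr
  collision fzero (fsuc (fsuc (fsuc fzero))) _ = ps
  collision (fsuc fzero) (fsuc (fsuc fzero)) _ = qr
  collision (fsuc fzero) (fsuc (fsuc (fsuc fzero))) _ = qs
  collision (fsuc (fsuc fzero)) (fsuc (fsuc (fsuc fzero))) _ = rs
  collision _ fzero ()
  collision (fsuc _) (fsuc fzero) (s≤s ())
  collision (fsuc (fsuc _)) (fsuc (fsuc fzero)) (s≤s (s≤s ()))
  collision (fsuc (fsuc (fsuc _))) (fsuc (fsuc (fsuc fzero))) (s≤s (s≤s (s≤s ())))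

-- Graph combinatorics: simple graphs with the properties (A) and (B).
module CoveringEdges {N : ℕ} (G : SimpleGraph N) where
  open SimpleGraph G renaming (sym to adj-sym)

  Covers : Fin N → Fin N → Fin N → Set
  Covers r c d = ∀ {i j} → Adj i j → ¬ Endpoint r i j → Endpoint i c d ⊎ Endpoint j c d

  DisjointEdgeProperty : Set
  DisjointEdgeProperty = ∀ {c d} → Adj c d → ∃₂ λ a b → Adj a b × Disjoint c d a b

  CoveringEdgeProperty : Set
  CoveringEdgeProperty =
    ∀ r {a b} → Adj a b → ¬ Endpoint r a b → ∃₂ λ c d → Adj c d × Covers r c d

  covered⇒meets : ∀ {i j c d : Fin N} → Endpoint i c d ⊎ Endpoint j c d → Meets c d i j
  covered⇒meets {i} (inj₁ i∈) = i , i∈ , inj₁ refl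
  covered⇒meets {j = j} (inj₂ j∈) = j , j∈ , inj₂ refl

  at-least-four : ∀ {u v a b} → Adj u v → Adj a b → Disjoint u v a b → 4 ≤ N
  at-least-four {u} {a = a} uv ab apart = four-distinct
    (λ { refl → irrefl u uv })
    (λ e → apart (inj₁ refl) (inj₁ e))
    (λ e → apart (inj₁ refl) (inj₂ e))
    (λ e → apart (inj₂ refl) (inj₁ e))
    (λ e → apart (inj₂ refl) (inj₂ e))
    (λ { refl → irrefl a ab })

  module Matching (disjointEdge : DisjointEdgeProperty) (coveringEdge : CoveringEdgeProperty)
    {u v a b : Fin N} (uv : Adj u v) (ab : Adj a b) (apart : Disjoint u v a b) where

    InU : Fin N → Set
    InU x = Endpoint x u v ⊎ Endpoint x a b

    Outside : Fin N → Set
    Outside r = ¬ Endpoint r u v × ¬ Endpoint r a b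

    outside⇒∉U : ∀ {r} → Outside r → ¬ InU r
    outside⇒∉U (r∉uv , _) (inj₁ r∈uv) = r∉uv r∈uv
    outside⇒∉U (_ , r∉ab) (inj₂ r∈ab) = r∉ab r∈ab

    Opposite : Fin N → Fin N → Set
    Opposite x y = (Endpoint x u v × Endpoint y a b) ⊎ (Endpoint x a b × Endpoint y u v)

    -- Being on opposite sides is a 2-colouring: no triangle is pairwise opposite.
    no-opposite-triangle : ∀ {x y z} → Opposite x y → Opposite x z → Opposite y z → ⊥
    no-opposite-triangle (inj₁ (_ , y∈ab)) (inj₁ _) (inj₁ (y∈uv , _)) = apart y∈uv y∈ab
    no-opposite-triangle (inj₁ _) (inj₁ (_ , z∈ab)) (inj₂ (_ , z∈uv)) = apart z∈uv z∈ab
    no-opposite-triangle (inj₁ (x∈uv , _)) (inj₂ (x∈ab , _)) _ = apart x∈uv x∈ab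
    no-opposite-triangle (inj₂ (x∈ab , _)) (inj₁ (x∈uv , _)) _ = apart x∈uv x∈ab
    no-opposite-triangle (inj₂ _) (inj₂ (_ , z∈uv)) (inj₁ (_ , z∈ab)) = apart z∈uv z∈ab
    no-opposite-triangle (inj₂ (_ , y∈uv)) (inj₂ _) (inj₂ (y∈ab , _)) = apart y∈uv y∈ab

    straddle : ∀ {c d} → Meets c d u v → Meets c d a b →
      ∃₂ λ t₁ t₂ → Endpoint t₁ u v × Endpoint t₂ a b × (∀ {z} → Endpoint z c d → Endpoint z t₁ t₂)
    straddle (t₁ , t₁∈cd , t₁∈uv) (t₂ , t₂∈cd , t₂∈ab) =
      t₁ , t₂ , t₁∈uv , t₂∈ab , exhaust t₁∈cd t₂∈cd (λ { refl → apart t₁∈uv t₂∈ab })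

    straddle-in-U : ∀ {c d z} → Meets c d u v → Meets c d a b → Endpoint z c d → InU z
    straddle-in-U m₁ m₂ z∈ with straddle m₁ m₂
    ... | _ , _ , t₁∈uv , t₂∈ab , on-sides with on-sides z∈
    ...   | inj₁ refl = inj₁ t₁∈uv
    ...   | inj₂ refl = inj₂ t₂∈ab

    straddle-opposite : ∀ {c d x y} → Meets c d u v → Meets c d a b →
      Endpoint x c d → Endpoint y c d → x ≢ y → Opposite x y
    straddle-opposite m₁ m₂ x∈ y∈ x≢y with straddle m₁ m₂
    ... | _ , _ , t₁∈uv , t₂∈ab , on-sides with on-sides x∈ | on-sides y∈
    ...   | inj₁ refl | inj₁ refl = ⊥-elim (x≢y refl)
    ...   | inj₂ refl | inj₂ refl = ⊥-elim (x≢y refl)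
    ...   | inj₁ refl | inj₂ refl = inj₁ (t₁∈uv , t₂∈ab)
    ...   | inj₂ refl | inj₁ refl = inj₂ (t₂∈ab , t₁∈uv)

    record Witness (r : Fin N) : Set where
      field
        c d s       : Fin N
        covers      : Covers r c d
        cover-in-U  : ∀ {z} → Endpoint z c d → InU z
        cover-sides : ∀ {x y} → Endpoint x c d → Endpoint y c d → x ≢ y → Opposite x y
        neighbour   : Adj r s
        s-off       : ¬ Endpoint s c d
    open Witness

    -- The edge disjoint from the covering edge (A) must contain r.
    witness : ∀ r → Outside r → Witness r
    witness r (r∉uv , r∉ab) with coveringEdge r uv r∉uv
    ... | c , d , cd , cov with disjointEdge cd
    ...   | s , t , st , off = record
      { c = c ; d = d ; s = proj₁ nb ; covers = cov
      ; cover-in-U = straddle-in-U meets-uv meets-ab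
      ; cover-sides = straddle-opposite meets-uv meets-ab
      ; neighbour = proj₁ (proj₂ nb) ; s-off = proj₂ (proj₂ nb) }
      where
      meets-uv : Meets c d u v
      meets-uv = covered⇒meets (cov uv r∉uv)
      meets-ab : Meets c d a b
      meets-ab = covered⇒meets (cov ab r∉ab)
      nb : ∃ λ s' → Adj r s' × ¬ Endpoint s' c d
      nb with s ≟ r | t ≟ r
      ... | yes refl | _ = t , st , λ t∈ → off t∈ (inj₂ refl)
      ... | no _ | yes refl = s , adj-sym st , λ s∈ → off s∈ (inj₁ refl)
      ... | no s≢r | no t≢r with cov st (avoids s≢r t≢r)
      ...   | inj₁ s∈ = ⊥-elim (off s∈ (inj₁ refl))
      ...   | inj₂ t∈ = ⊥-elim (off t∈ (inj₂ refl))

    -- A neighbour s of an outside vertex r lies on the covering edge of any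
    -- other outside vertex r' ≠ s, since r itself is not in U.
    pinned : ∀ {r r' s} → Outside r → r ≢ r' → Adj r s → s ≢ r' →
      (W' : Witness r') → Endpoint s (c W') (d W')
    pinned out r≢r' rs s≢r' W' with covers W' rs (avoids r≢r' s≢r')
    ... | inj₁ r∈ = ⊥-elim (outside⇒∉U out (cover-in-U W' r∈))
    ... | inj₂ s∈ = s∈

    -- Among two further outside vertices one differs from s, so s ∈ U.
    neighbour-in-U : ∀ {r r' r''} → Outside r → r ≢ r' → r ≢ r'' → r' ≢ r'' →
      (W : Witness r) → Witness r' → Witness r'' → InU (s W)
    neighbour-in-U {r' = r'} out r≢r' r≢r'' r'≢r'' W W' W'' with s W ≟ r'
    ... | no s≢r' = cover-in-U W' (pinned out r≢r' (neighbour W) s≢r' W')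
    ... | yes refl = cover-in-U W'' (pinned out r≢r'' (neighbour W) r'≢r'' W'')

    on-other-cover : ∀ {r r'} → Outside r → Outside r' → r ≢ r' →
      (W : Witness r) → InU (s W) → (W' : Witness r') → Endpoint (s W) (c W') (d W')
    on-other-cover out out' r≢r' W s∈U W' =
      pinned out r≢r' (neighbour W) (λ { refl → outside⇒∉U out' s∈U }) W'

    no-three-outside : ∀ {r₁ r₂ r₃} → Outside r₁ → Outside r₂ → Outside r₃ →
      r₁ ≢ r₂ → r₁ ≢ r₃ → r₂ ≢ r₃ → ⊥
    no-three-outside {r₁} {r₂} {r₃} o₁ o₂ o₃ r₁₂ r₁₃ r₂₃ =
      no-opposite-triangle
        (cover-sides W₃ s₁∈e₃ s₂∈e₃ (separated s₁∈e₂ (s-off W₂)))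
        (cover-sides W₂ s₁∈e₂ s₃∈e₂ (separated s₁∈e₃ (s-off W₃)))
        (cover-sides W₁ s₂∈e₁ s₃∈e₁ (separated s₂∈e₃ (s-off W₃)))
      where
      W₁ = witness r₁ o₁
      W₂ = witness r₂ o₂
      W₃ = witness r₃ o₃
      s₁∈U = neighbour-in-U o₁ r₁₂ r₁₃ r₂₃ W₁ W₂ W₃
      s₂∈U = neighbour-in-U o₂ (≢-sym r₁₂) r₂₃ r₁₃ W₂ W₁ W₃
      s₃∈U = neighbour-in-U o₃ (≢-sym r₁₃) (≢-sym r₂₃) r₁₂ W₃ W₁ W₂
      s₁∈e₂ = on-other-cover o₁ o₂ r₁₂ W₁ s₁∈U W₂
      s₁∈e₃ = on-other-cover o₁ o₃ r₁₃ W₁ s₁∈U W₃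
      s₂∈e₁ = on-other-cover o₂ o₁ (≢-sym r₁₂) W₂ s₂∈U W₁
      s₂∈e₃ = on-other-cover o₂ o₃ r₂₃ W₂ s₂∈U W₃
      s₃∈e₁ = on-other-cover o₃ o₁ (≢-sym r₁₃) W₃ s₃∈U W₁
      s₃∈e₂ = on-other-cover o₃ o₂ (≢-sym r₂₃) W₃ s₃∈U W₂

    outside-of : ∀ {w L} → w ∉ u ∷ v ∷ a ∷ b ∷ L → Outside w
    outside-of w∉ =
      (λ { (inj₁ e) → w∉ (here e) ; (inj₂ e) → w∉ (there (here e)) }) ,
      (λ { (inj₁ e) → w∉ (there (there (here e)))
         ; (inj₂ e) → w∉ (there (there (there (here e)))) })

    -- With seven or more vertices, three of them lie outside U.
    at-most-six : N ≤ 6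
    at-most-six = ≮⇒≥ λ six<N →
      let five<N = <-trans (n<1+n 5) six<N
          four<N = <-trans (n<1+n 4) five<N
          (r₁ , r₁∉) = missing (u ∷ v ∷ a ∷ b ∷ []) four<N
          (r₂ , r₂∉) = missing (u ∷ v ∷ a ∷ b ∷ r₁ ∷ []) five<N
          (r₃ , r₃∉) = missing (u ∷ v ∷ a ∷ b ∷ r₁ ∷ r₂ ∷ []) six<N
      in no-three-outside (outside-of r₁∉) (outside-of r₂∉) (outside-of r₃∉)
           (fifth r₂∉) (fifth r₃∉) (sixth r₃∉)
      where
      fifth : ∀ {w x L} → w ∉ u ∷ v ∷ a ∷ b ∷ x ∷ L → x ≢ w
      fifth w∉ e = w∉ (there (there (there (there (here (sym e))))))
      sixth : ∀ {w x y L} → w ∉ u ∷ v ∷ a ∷ b ∷ x ∷ y ∷ L → y ≢ w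
      sixth w∉ e = w∉ (there (there (there (there (there (here (sym e)))))))

  between-four-and-six : DisjointEdgeProperty → CoveringEdgeProperty →
    ∀ {u v} → Adj u v → 4 ≤ N × N ≤ 6
  between-four-and-six disjointEdge coveringEdge uv with disjointEdge uv
  ... | _ , _ , ab , apart =
    at-least-four uv ab apart , Matching.at-most-six disjointEdge coveringEdge uv ab apart

minPos≤ : ∀ {n} (x : Pos (suc n)) i → minPos x ≤ x i
minPos≤ {zero} x fzero = ≤-refl
minPos≤ {suc n} x fzero = m⊓n≤m _ _
minPos≤ {suc n} x (fsuc i) = ≤-trans (m⊓n≤n (x fzero) _) (minPos≤ (λ k → x (fsuc k)) i)

ones : ∀ {N} → Pos N
ones _ = 1

minPos-ones : ∀ n → minPos {n} ones ≡ 1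
minPos-ones zero = refl
minPos-ones (suc n) rewrite minPos-ones n = refl

-- A position with an empty pile has m = 0, so its f-value is its height.
fH-with-zero : ∀ {n} (h : Pos (suc n) → ℕ) (x : Pos (suc n)) w → x w ≡ 0 → fH h x ≡ h x
fH-with-zero h x w xw≡0 rewrite n≤0⇒n≡0 (subst (minPos x ≤_) xw≡0 (minPos≤ x w)) = refl

-- The all-ones position has f-value 0 (m = 1, y = h(0) + 1 = 1).
fH-ones : ∀ {n} (h : Pos (suc n) → ℕ) → h (λ _ → 0) ≡ 0 → fH h ones ≡ 0
fH-ones {n} h h0 rewrite minPos-ones n | h0 = refl

clear : ∀ {N} → Fin N → Fin N → Pos N → Pos N
clear c d x k with endpoint? k c d
... | yes _ = 0
... | no _ = x k

clear-on : ∀ {N} {c d k : Fin N} (x : Pos N) → Endpoint k c d → clear c d x k ≡ 0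
clear-on {c = c} {d} {k} x k∈ with endpoint? k c d
... | yes _ = refl
... | no k∉ = ⊥-elim (k∉ k∈)

clear-off : ∀ {N} {c d k : Fin N} (x : Pos N) → ¬ Endpoint k c d → clear c d x k ≡ x k
clear-off {c = c} {d} {k} x k∉ with endpoint? k c d
... | yes k∈ = ⊥-elim (k∉ k∈)
... | no _ = refl

∈pair⇒endpoint : ∀ {N} {i j k : Fin N} → k ∈ˢ ⁅ i ⁆ ∪ ⁅ j ⁆ → Endpoint k i j
∈pair⇒endpoint {i = i} {j} k∈ with x∈p∪q⁻ ⁅ i ⁆ ⁅ j ⁆ k∈
... | inj₁ k∈i = inj₁ (x∈⁅y⁆⇒x≡y i k∈i)
... | inj₂ k∈j = inj₂ (x∈⁅y⁆⇒x≡y j k∈j)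

endpoint⇒∈pair : ∀ {N} {i j k : Fin N} → Endpoint k i j → k ∈ˢ ⁅ i ⁆ ∪ ⁅ j ⁆
endpoint⇒∈pair {i = i} (inj₁ refl) = x∈p∪q⁺ (inj₁ (x∈⁅x⁆ i))
endpoint⇒∈pair {j = j} (inj₂ refl) = x∈p∪q⁺ (inj₂ (x∈⁅x⁆ j))

module EdgeMoves {N : ℕ} (G : SimpleGraph N) where
  open SimpleGraph G using (Adj)

  Moves : Pos N → Pos N → Set
  Moves = Move (edgeHypergraph G)

  edge-move : ∀ {i j} (x : Pos N) → Adj i j → (∀ k → Endpoint k i j → 0 < x k) →
    Moves x (clear i j x)
  edge-move {i} {j} x ij positive = ⁅ i ⁆ ∪ ⁅ j ⁆ , (i , j , ij , refl) , λ k →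
      (λ k∈ → subst (_< x k) (sym (clear-on x (∈pair⇒endpoint k∈)))
                                  (positive k (∈pair⇒endpoint k∈)))
    , (λ k∉ → clear-off x (λ k∈ → k∉ (endpoint⇒∈pair k∈)))

  move-edge : ∀ {x x'} → Moves x x' → ∃₂ λ i j → Adj i j ×
    (∀ k → Endpoint k i j → x' k < x k) × (∀ k → ¬ Endpoint k i j → x' k ≡ x k)
  move-edge (_ , (i , j , ij , refl) , effect) = i , j , ij
    , (λ k k∈ → proj₁ (effect k) (endpoint⇒∈pair k∈))
    , (λ k k∉ → proj₂ (effect k) (λ k∈ → k∉ (∈pair⇒endpoint k∈)))

-- Properties (A) and (B) for a JM graph, with height h and Sprague–Grundy
-- function fH h.
module JMGraph {n : ℕ} (G : SimpleGraph (suc n)) (h : Pos (suc n) → ℕ)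
  (height : IsHeight (edgeHypergraph G) h) (grundy : IsSG (edgeHypergraph G) (fH h)) where
  open SimpleGraph G using (Adj)
  open EdgeMoves G
  open CoveringEdges G using (Covers; DisjointEdgeProperty; CoveringEdgeProperty)

  move⇒height>0 : ∀ {x x'} → Moves x x' → 0 < h x
  move⇒height>0 {x} mv = proj₂ (height x) 1 (step mv stop)

  height>0⇒move : ∀ x → 0 < h x → ∃ (Moves x)
  height>0⇒move x _ with h x | proj₁ (height x)
  ... | suc _ | step mv _ = _ , mv

  height-0⇒stuck : ∀ {x x'} → h x ≡ 0 → ¬ Moves x x'
  height-0⇒stuck h≡0 mv = n≮0 (subst (0 <_) h≡0 (move⇒height>0 mv))

  -- No pile of the zero position can be decreased.
  height-zeros : h (λ _ → 0) ≡ 0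
  height-zeros = n≤0⇒n≡0 (≮⇒≥ λ pos →
    let (i , _ , _ , decrease , _) = move-edge (proj₂ (height>0⇒move _ pos))
    in n≮0 (decrease i (inj₁ refl)))

  -- Playing an edge {c,d} from the all-ones position (value 0) leads to a
  -- position with an empty pile, whose value is its height; that value
  -- differs from 0.
  height-after-edge>0 : ∀ {c d} → Adj c d → 0 < h (clear c d ones)
  height-after-edge>0 {c} {d} cd = n≢0⇒n>0 λ h≡0 →
    proj₁ (grundy ones) (clear c d ones) (edge-move ones cd (λ _ _ → s≤s z≤n)) (begin
      fH h (clear c d ones) ≡⟨ fH-with-zero h _ c (clear-on {c = c} {d} ones (inj₁ refl)) ⟩
      h (clear c d ones)    ≡⟨ h≡0 ⟩
      0                     ≡⟨ sym (fH-ones h height-zeros) ⟩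
      fH h ones             ∎)
    where open ≡-Reasoning

  -- (A): a move from clear c d ones uses an edge avoiding the empty piles c, d.
  disjoint-edge : DisjointEdgeProperty
  disjoint-edge {c} {d} cd with height>0⇒move (clear c d ones) (height-after-edge>0 cd)
  ... | x' , mv with move-edge mv
  ...   | a , b , ab , decrease , _ = a , b , ab , λ {t} t∈cd t∈ab →
    n≮0 (subst (x' t <_) (clear-on {c = c} {d} ones t∈cd) (decrease t t∈ab))

  ones-but : Fin (suc n) → Pos (suc n)
  ones-but r = clear r r ones

  ones-but≤1 : ∀ r k → ones-but r k ≤ 1
  ones-but≤1 r k with endpoint? k r r
  ... | yes _ = z≤n
  ... | no _ = ≤-refl

  ones-but>0 : ∀ {r i j k} → ¬ Endpoint r i j → Endpoint k i j → 0 < ones-but r k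
  ones-but>0 {r} {i} {j} {k} r∉ij k∈ij =
    subst (0 <_) (sym (clear-off ones (λ k∈rr → r∉ij (same-vertex k∈rr)))) (s≤s z≤n)
    where
    same-vertex : Endpoint k r r → Endpoint r i j
    same-vertex (inj₁ refl) = k∈ij
    same-vertex (inj₂ refl) = k∈ij

  -- If G − r has an edge, the value of ones-but r equals its height, which
  -- is positive.
  value-ones-but>0 : ∀ {r a b} → Adj a b → ¬ Endpoint r a b → 0 < fH h (ones-but r)
  value-ones-but>0 {r} ab r∉ab =
    subst (0 <_) (sym (fH-with-zero h (ones-but r) r (clear-on {c = r} {r} ones (inj₁ refl))))
      (move⇒height>0 (edge-move (ones-but r) ab (λ _ → ones-but>0 r∉ab)))

  -- (B): some move from ones-but r, along an edge {c,d}, reaches value 0.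
  -- That position has an empty pile c, so its height is 0: no edge of
  -- G − r avoiding {c,d} is still playable, i.e. {c,d} covers G − r.
  covering-edge : CoveringEdgeProperty
  covering-edge r ab r∉ab with proj₂ (grundy (ones-but r)) 0 (value-ones-but>0 ab r∉ab)
  ... | x' , mv , value≡0 with move-edge mv
  ...   | c , d , cd , decrease , fixed = c , d , cd , covers
    where
    height≡0 : h x' ≡ 0
    height≡0 = trans (sym (fH-with-zero h x' c x'-c≡0)) value≡0
      where
      x'-c≡0 : x' c ≡ 0
      x'-c≡0 = n<1⇒n≡0 (≤-trans (decrease c (inj₁ refl)) (ones-but≤1 r c))
    covers : Covers r c d
    covers {i} {j} ij r∉ij with endpoint? i c d | endpoint? j c d
    ... | yes i∈ | _ = inj₁ i∈
    ... | no _ | yes j∈ = inj₂ j∈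
    ... | no i∉ | no j∉ = ⊥-elim (height-0⇒stuck height≡0 (edge-move x' ij x'>0))
      where
      x'>0 : ∀ k → Endpoint k i j → 0 < x' k
      x'>0 k (inj₁ refl) = subst (0 <_) (sym (fixed k i∉)) (ones-but>0 r∉ij (inj₁ refl))
      x'>0 k (inj₂ refl) = subst (0 <_) (sym (fixed k j∉)) (ones-but>0 r∉ij (inj₂ refl))

lemma5p15 : (n : ℕ) (G : SimpleGraph (suc n)) → NoIsolated G →
    JM (edgeHypergraph G) → 4 ≤ suc n × suc n ≤ 6
lemma5p15 n G noIsolated (h , height , grundy) =
  between-four-and-six disjoint-edge covering-edge (proj₂ (noIsolated fzero))
  where
  open CoveringEdges G using (between-four-and-six)
  open JMGraph G h height grundy using (disjoint-edge; covering-edge)
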